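{- Let $H$ be a connected imperfect graph with no induced $K_3$ and no induced $P_2\cup P_3$, with the setup of the context. Then for every $i\in\{1,\dots,5\}$ (indices mod 5): (P1) $|A_i|\le 1$; (P2) $B_i$ is an independent set; (P3) there are no edges between $A_i$ and $A_{i+1}$, and $A_i$ is complete to $A_{i+2}$; (P4) $A_i$ is anticomplete to $B_i$ and complete to $B_{i-2}\cup B_{i+2}$; (P5) $A_i$ is anticomplete to $B_{i-1}\cup B_{i+1}$; (P6) $B_i$ is anticomplete to $B_{i+2}$; (P7) for each $b\in B_i$ and $j\in\{i-1,i+1\}$, $|N(b)\cap B_j|\ge|B_j|-1$; (P8) if $A_i\ne\emptyset$ then $B_{i-2}$ is anticomplete to $B_{i+2}$; (P9) $S_j=\emptyset$ for all $j\ge3$, and $S_2$ is an independent set; (P10) $A_i$ is anticomplete to $S_2$; (P11) for each $z\in S_2$, $|N(z)\cap B_i|\le 1$; for each $y\in B_i$, $|N(y)\cap S_2|\le1$; and $\sum_{j=1}^5|B_j|\ge|S_2|$.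
   Context: $P_2\cup P_3$ is the disjoint union of a path on 2 vertices and a path on 3 vertices. Imperfect: some induced subgraph $F$ has $\chi(F)>\omega(F)$; such $H$ contains an induced 5-cycle. Setup: fix an induced 5-cycle in $H$ with vertices $v_1,\dots,v_5$ in cyclic order, indices mod 5, $S_0=\{v_1,\dots,v_5\}$; for $x\notin S_0$ let $d(x,S_0)$ be the distance from $x$ to $S_0$ and $S_k=\{x\notin S_0: d(x,S_0)=k\}$; $A_i=\{x\in S_1: N(x)\cap S_0=\{v_i\}\}$, $B_i=\{x\in S_1:N(x)\cap S_0=\{v_{i-1},v_{i+1}\}\}$. "$X$ complete to $Y$" means every vertex of $X$ is adjacent to every vertex of $Y$; "anticomplete" means no edges between them. -}

module Defs where

open import Data.Nat using (ℕ; zero; suc; _+_; _≤_; _<_; _∸_)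
open import Data.Bool using (Bool; true; false; _∧_; _∨_; not; if_then_else_)
open import Data.Fin using (Fin; zero; suc; _≟_)
open import Data.Product using (Σ; ∃; _×_; _,_)
open import Data.Sum using (_⊎_)
open import Relation.Nullary using (¬_)
open import Relation.Nullary.Decidable using (⌊_⌋)
open import Relation.Binary.PropositionalEquality using (_≡_; _≢_)
open import Function.Definitions using (Injective)

record Graph : Set where
  field
    n     : ℕ
    adj   : Fin n → Fin n → Bool
    sym   : ∀ x y → adj x y ≡ adj y x
    irrefl : ∀ x → adj x x ≡ false

open Graph public

anyF : ∀ {m} → (Fin m → Bool) → Bool
anyF {zero}  p = false
anyF {suc m} p = p zero ∨ anyF (λ i → p (suc i))

allF : ∀ {m} → (Fin m → Bool) → Bool
allF {zero}  p = true
allF {suc m} p = p zero ∧ allF (λ i → p (suc i))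

count : ∀ {m} → (Fin m → Bool) → ℕ
count {zero}  p = 0
count {suc m} p = (if p zero then 1 else 0) + count (λ i → p (suc i))

_==ᶠ_ : ∀ {m} → Fin m → Fin m → Bool
i ==ᶠ j = ⌊ i ≟ j ⌋

_⇔ᵇ_ : Bool → Bool → Bool
true  ⇔ᵇ b = b
false ⇔ᵇ b = not b

data Walk (G : Graph) : Fin (n G) → Fin (n G) → Set where
  [] : ∀ {x} → Walk G x x
  step : ∀ {x y z} → adj G x y ≡ true → Walk G y z → Walk G x z

Connected : Graph → Set
Connected G = ∀ x y → Walk G x y

HasInduced : ∀ {m} → (G : Graph) → (Fin m → Fin m → Bool) → Set
HasInduced {m} G F =
  Σ (Fin m → Fin (n G)) λ f →
    Injective _≡_ _≡_ f × (∀ i j → adj G (f i) (f j) ≡ F i j)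

K3 : Fin 3 → Fin 3 → Bool
K3 i j = not (i ==ᶠ j)

-- P_2 ∪ P_3 : vertices 0-1 (the P_2) and 2-3-4 (the P_3)
P2∪P3 : Fin 5 → Fin 5 → Bool
P2∪P3 zero (suc zero) = true
P2∪P3 (suc zero) zero = true
P2∪P3 (suc (suc zero)) (suc (suc (suc zero))) = true
P2∪P3 (suc (suc (suc zero))) (suc (suc zero)) = true
P2∪P3 (suc (suc (suc zero))) (suc (suc (suc (suc zero)))) = true
P2∪P3 (suc (suc (suc (suc zero)))) (suc (suc (suc zero))) = true
P2∪P3 _ _ = false

next : Fin 5 → Fin 5
next zero = suc zero
next (suc zero) = suc (suc zero)
next (suc (suc zero)) = suc (suc (suc zero))
next (suc (suc (suc zero))) = suc (suc (suc (suc zero)))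
next (suc (suc (suc (suc zero)))) = zero

prev : Fin 5 → Fin 5
prev zero = suc (suc (suc (suc zero)))
prev (suc zero) = zero
prev (suc (suc zero)) = suc zero
prev (suc (suc (suc zero))) = suc (suc zero)
prev (suc (suc (suc (suc zero)))) = suc (suc (suc zero))

C5 : Fin 5 → Fin 5 → Bool
C5 i j = (j ==ᶠ next i) ∨ (i ==ᶠ next j)

module _ (G : Graph) where

  VSet : Set
  VSet = Fin (n G) → Bool

  IsClique : VSet → VSet → Set
  IsClique U C = (∀ x → C x ≡ true → U x ≡ true)
               × (∀ x y → C x ≡ true → C y ≡ true → x ≢ y → adj G x y ≡ true)

  IsCliqueNumber : VSet → ℕ → Set
  IsCliqueNumber U w = (∃ λ C → IsClique U C × count C ≡ w)
                     × (∀ C → IsClique U C → count C ≤ w)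

  Colourable : VSet → ℕ → Set
  Colourable U k = Σ (Fin (n G) → Fin k) λ c →
    ∀ x y → U x ≡ true → U y ≡ true → adj G x y ≡ true → c x ≢ c y

  IsChromaticNumber : VSet → ℕ → Set
  IsChromaticNumber U k = Colourable U k × (∀ m → Colourable U m → k ≤ m)

  Imperfect : Set
  Imperfect = Σ VSet λ U → Σ ℕ λ w → Σ ℕ λ k →
    IsCliqueNumber U w × IsChromaticNumber U k × w < k

  Complete Anticomplete : VSet → VSet → Set
  Complete X Y = ∀ x y → X x ≡ true → Y y ≡ true → adj G x y ≡ true
  Anticomplete X Y = ∀ x y → X x ≡ true → Y y ≡ true → adj G x y ≡ false

  Independent : VSet → Set
  Independent X = Anticomplete X X

  Nbr∩ : Fin (n G) → VSet → VSet
  Nbr∩ x X y = adj G x y ∧ X y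

  module Setup (v : Fin 5 → Fin (n G)) where

    S0 : VSet
    S0 x = anyF (λ j → v j ==ᶠ x)

    within : ℕ → VSet
    within zero x = S0 x
    within (suc k) x = within k x ∨ anyF (λ y → adj G x y ∧ within k y)

    S : ℕ → VSet
    S zero x = S0 x
    S (suc k) x = within (suc k) x ∧ not (within k x)

    A : Fin 5 → VSet
    A i x = S 1 x ∧ allF (λ j → adj G x (v j) ⇔ᵇ (j ==ᶠ i))

    B : Fin 5 → VSet
    B i x = S 1 x ∧ allF (λ j → adj G x (v j) ⇔ᵇ ((j ==ᶠ prev i) ∨ (j ==ᶠ next i)))

    IsInducedC5 : Set
    IsInducedC5 = Injective _≡_ _≡_ v × (∀ i j → adj G (v i) (v j) ≡ C5 i j)

{-# OPTIONS --safe #-}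
module Submission where

open import Defs
open import Data.Nat using (ℕ; zero; suc; _+_; _≤_; _∸_; _≥_; z≤n; s≤s)
open import Data.Nat.Properties
  using (≤-refl; ≤-trans; ≤-reflexive; m≤m+n; m≤n+m; +-mono-≤; +-monoʳ-≤; ∸-monoˡ-≤; m+n∸n≡m;
         +-0-commutativeMonoid; module ≤-Reasoning)
open import Data.Nat.Solver using (module +-*-Solver)
open import Algebra.Properties.CommutativeMonoid.Sum +-0-commutativeMonoid
  using (sum; sum-syntax; ∑-comm; ∑-distrib-+; sum-replicate-zero)
open import Data.Bool using (Bool; true; false; _∧_; _∨_; not; if_then_else_)
open import Data.Bool.Properties using (∧-conicalˡ; ∧-conicalʳ; ∨-conicalˡ; ∨-zeroʳ) renaming (_≟_ to _≟ᵇ_)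
open import Data.Fin using (Fin; zero; suc)
open import Data.Fin.Patterns using (0F; 1F; 2F; 3F; 4F)
open import Data.Fin.Properties using (all?; any?; suc-injective) renaming (_≟_ to _≟ᶠ_)
open import Data.Product using (∃; _×_; _,_)
open import Data.Sum using (_⊎_; inj₁; inj₂; [_,_]′)
open import Data.Empty using (⊥; ⊥-elim)
open import Function using (_∘_; id)
open import Function.Definitions using (Injective)
open import Relation.Nullary using (¬_; yes; no)
open import Relation.Nullary.Decidable using (toWitness; _→-dec_; _⊎-dec_; _×-dec_)
open import Relation.Binary.PropositionalEquality as ≡
  using (_≡_; _≢_; refl; trans; cong; cong₂; subst; ≢-sym; module ≡-Reasoning)

-- Every claim is proved by turning a counterexample into a triangle or an induced
-- P₂ ∪ P₃, in most cases with an edge of the 5-cycle as the P₂, after rotating the cycle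
-- to start at vᵢ. Triangle-freeness makes N(y) ∩ S₀ a single vertex or two vertices at
-- distance two for every y ∈ S₁, so S₁ is the union of the Aₖ and Bₖ, and every y ∈ S₁
-- misses an edge of the cycle. An induced path y – z – w with z, w outside S₀ ∪ S₁ would
-- complete that edge to a P₂ ∪ P₃; this rules out S₃ and edges inside S₂. Finally, every
-- vertex of S₂ has a neighbour in some Bₖ (not in Aₖ, by (P10)) and every vertex of Bₖ
-- has at most one neighbour in S₂, so double counting gives |S₂| ≤ Σₖ |Bₖ|.

≢true⇒≡false : ∀ {b} → b ≢ true → b ≡ false
≢true⇒≡false {false} _ = refl
≢true⇒≡false {true} b≢true = ⊥-elim (b≢true refl)

≢false⇒≡true : ∀ {b} → b ≢ false → b ≡ true
≢false⇒≡true {true} _ = refl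
≢false⇒≡true {false} b≢false = ⊥-elim (b≢false refl)

≡true⇒≢false : ∀ {b} → b ≡ true → b ≢ false
≡true⇒≢false refl ()

not≡true⇒≡false : ∀ {b} → not b ≡ true → b ≡ false
not≡true⇒≡false {false} _ = refl

separates⇒≢ : ∀ {A : Set} (p : A → Bool) {x y} → p x ≡ true → p y ≡ false → x ≢ y
separates⇒≢ p px py refl = ≡true⇒≢false px py

==ᶠ⇒≡ : ∀ {m} (i j : Fin m) → (i ==ᶠ j) ≡ true → i ≡ j
==ᶠ⇒≡ i j i==j with i ≟ᶠ j
... | yes i≡j = i≡j

==ᶠ-refl : ∀ {m} (i : Fin m) → (i ==ᶠ i) ≡ true
==ᶠ-refl i with i ≟ᶠ i
... | yes _ = refl
... | no i≢i = ⊥-elim (i≢i refl)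

allF-elim : ∀ {m} {p : Fin m → Bool} → allF p ≡ true → ∀ j → p j ≡ true
allF-elim {p = p} all zero = ∧-conicalˡ (p zero) _ all
allF-elim {p = p} all (suc j) = allF-elim (∧-conicalʳ (p zero) _ all) j

allF-intro : ∀ {m} {p : Fin m → Bool} → (∀ j → p j ≡ true) → allF p ≡ true
allF-intro {zero} _ = refl
allF-intro {suc m} all = cong₂ _∧_ (all zero) (allF-intro (all ∘ suc))

anyF-elim : ∀ {m} {p : Fin m → Bool} → anyF p ≡ true → ∃ λ j → p j ≡ true
anyF-elim {suc m} {p} some with p zero in p0
... | true = zero , p0
... | false with anyF-elim some
...   | j , pj = suc j , pj

anyF-intro : ∀ {m} {p : Fin m → Bool} j → p j ≡ true → anyF p ≡ true
anyF-intro {p = p} zero pj = cong (_∨ anyF (p ∘ suc)) pj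
anyF-intro {p = p} (suc j) pj = trans (cong (p zero ∨_) (anyF-intro j pj)) (∨-zeroʳ (p zero))

allF-⇔ᵇ-elim : ∀ {m} {f g : Fin m → Bool} → allF (λ j → f j ⇔ᵇ g j) ≡ true → ∀ j → f j ≡ g j
allF-⇔ᵇ-elim all j = ⇔ᵇ⇒≡ (allF-elim all j)
  where
  ⇔ᵇ⇒≡ : ∀ {a b} → (a ⇔ᵇ b) ≡ true → a ≡ b
  ⇔ᵇ⇒≡ {true} {true} _ = refl
  ⇔ᵇ⇒≡ {false} {false} _ = refl

allF-⇔ᵇ-intro : ∀ {m} {f g : Fin m → Bool} → (∀ j → f j ≡ g j) → allF (λ j → f j ⇔ᵇ g j) ≡ true
allF-⇔ᵇ-intro f≗g = allF-intro λ j → ≡⇒⇔ᵇ (f≗g j)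
  where
  ≡⇒⇔ᵇ : ∀ {a b} → a ≡ b → (a ⇔ᵇ b) ≡ true
  ≡⇒⇔ᵇ {true} refl = refl
  ≡⇒⇔ᵇ {false} refl = refl

𝟙 : Bool → ℕ
𝟙 b = if b then 1 else 0

count≡∑𝟙 : ∀ {m} (p : Fin m → Bool) → count p ≡ ∑[ x < m ] 𝟙 (p x)
count≡∑𝟙 {zero} p = refl
count≡∑𝟙 {suc m} p = cong (𝟙 (p zero) +_) (count≡∑𝟙 (p ∘ suc))

sum-mono : ∀ {m} {f g : Fin m → ℕ} → (∀ x → f x ≤ g x) → sum f ≤ sum g
sum-mono {zero} _ = z≤n
sum-mono {suc m} f≤g = +-mono-≤ (f≤g zero) (sum-mono (f≤g ∘ suc))

term≤sum : ∀ {m} (f : Fin m → ℕ) x → f x ≤ sum f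
term≤sum f zero = m≤m+n _ _
term≤sum f (suc x) = ≤-trans (term≤sum (f ∘ suc) x) (m≤n+m _ _)

count≡0 : ∀ {m} {p : Fin m → Bool} → (∀ x → p x ≡ false) → count p ≡ 0
count≡0 {zero} _ = refl
count≡0 {suc m} none rewrite none zero = count≡0 (none ∘ suc)

count≤1 : ∀ {m} {p : Fin m → Bool} → (∀ {x y} → x ≢ y → p x ≡ true → p y ≡ true → ⊥) → count p ≤ 1
count≤1 {zero} _ = z≤n
count≤1 {suc m} {p} no-two with p zero in p0
... | true = s≤s (≤-reflexive (count≡0 {p = p ∘ suc} λ x → ≢true⇒≡false (no-two {y = suc x} (λ ()) p0)))
... | false = count≤1 λ x≢y → no-two (x≢y ∘ suc-injective)

count≤+ : ∀ {m} {p q r : Fin m → Bool} → (∀ x → 𝟙 (p x) ≤ 𝟙 (q x) + 𝟙 (r x))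
  → count p ≤ count q + count r
count≤+ {m} {p} {q} {r} pointwise = begin
  count p                                  ≡⟨ count≡∑𝟙 p ⟩
  ∑[ x < m ] 𝟙 (p x)                       ≤⟨ sum-mono pointwise ⟩
  ∑[ x < m ] (𝟙 (q x) + 𝟙 (r x))           ≡⟨ ∑-distrib-+ (𝟙 ∘ q) (𝟙 ∘ r) ⟩
  ∑[ x < m ] 𝟙 (q x) + ∑[ x < m ] 𝟙 (r x)  ≡⟨ cong₂ _+_ (count≡∑𝟙 q) (count≡∑𝟙 r) ⟨
  count q + count r                        ∎
  where open ≤-Reasoning

count-∨ : ∀ {m} (p q : Fin m → Bool) → count (λ x → p x ∨ q x) ≤ count p + count q
count-∨ p q = count≤+ λ x → 𝟙-∨ (p x) (q x)
  where
  𝟙-∨ : ∀ a b → 𝟙 (a ∨ b) ≤ 𝟙 a + 𝟙 b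
  𝟙-∨ true _ = s≤s z≤n
  𝟙-∨ false _ = ≤-refl

count-anyF : ∀ {k m} (P : Fin k → Fin m → Bool) → count (λ x → anyF (λ j → P j x)) ≤ ∑[ j < k ] count (P j)
count-anyF {zero} {m} P = ≤-reflexive (count≡0 {m} {λ _ → false} λ _ → refl)
count-anyF {suc k} P =
  ≤-trans (count-∨ (P zero) (λ x → anyF (λ j → P (suc j) x))) (+-monoʳ-≤ (count (P zero)) (count-anyF (P ∘ suc)))

count∸1≤count-∧ : ∀ {m} (p X : Fin m → Bool)
  → (∀ {x y} → x ≢ y → X x ≡ true → X y ≡ true → p x ≡ false → p y ≡ false → ⊥)
  → count X ∸ 1 ≤ count (λ x → p x ∧ X x)
count∸1≤count-∧ p X one-miss = begin
  count X ∸ 1                      ≤⟨ ∸-monoˡ-≤ 1 (≤-trans split (+-monoʳ-≤ (count hits) at-most-one-miss)) ⟩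
  count hits + 1 ∸ 1               ≡⟨ m+n∸n≡m (count hits) 1 ⟩
  count hits                       ∎
  where
  open ≤-Reasoning
  hits misses : Fin _ → Bool
  hits x = p x ∧ X x
  misses x = not (p x) ∧ X x
  split : count X ≤ count hits + count misses
  split = count≤+ λ x → 𝟙-split (p x) (X x)
    where
    𝟙-split : ∀ a b → 𝟙 b ≤ 𝟙 (a ∧ b) + 𝟙 (not a ∧ b)
    𝟙-split true b = m≤m+n (𝟙 b) 0
    𝟙-split false b = ≤-refl
  at-most-one-miss : count misses ≤ 1
  at-most-one-miss = count≤1 λ {x} {y} x≢y mx my →
    one-miss x≢y (∧-conicalʳ (not (p x)) (X x) mx) (∧-conicalʳ (not (p y)) (X y) my)
      (not≡true⇒≡false (∧-conicalˡ (not (p x)) (X x) mx)) (not≡true⇒≡false (∧-conicalˡ (not (p y)) (X y) my))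

double-counting : ∀ {m} (R : Fin m → Fin m → Bool) {P Q : Fin m → Bool}
  → (∀ x → P x ≡ true → ∃ λ y → Q y ≡ true × R y x ≡ true)
  → (∀ y → Q y ≡ true → count (λ x → R y x ∧ P x) ≤ 1)
  → count P ≤ count Q
double-counting {m} R {P} {Q} covered unique = begin
  count P                           ≡⟨ count≡∑𝟙 P ⟩
  ∑[ x < m ] 𝟙 (P x)                ≤⟨ sum-mono covered-once ⟩
  ∑[ x < m ] ∑[ y < m ] incidence x y ≡⟨ ∑-comm incidence ⟩
  ∑[ y < m ] ∑[ x < m ] incidence x y ≤⟨ sum-mono unique-once ⟩
  ∑[ y < m ] 𝟙 (Q y)                ≡⟨ count≡∑𝟙 Q ⟨
  count Q                           ∎
  where
  open ≤-Reasoning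
  incidence : Fin m → Fin m → ℕ
  incidence x y = 𝟙 (Q y ∧ (R y x ∧ P x))
  covered-once : ∀ x → 𝟙 (P x) ≤ ∑[ y < m ] incidence x y
  covered-once x = 𝟙-≤ λ px →
    let y , qy , ryx = covered x px
    in ≤-trans (≤-reflexive (cong 𝟙 (≡.sym (cong₂ _∧_ qy (cong₂ _∧_ ryx px))))) (term≤sum (incidence x) y)
    where
    𝟙-≤ : ∀ {b s} → (b ≡ true → 1 ≤ s) → 𝟙 b ≤ s
    𝟙-≤ {true} one≤s = one≤s refl
    𝟙-≤ {false} _ = z≤n
  unique-once : ∀ y → ∑[ x < m ] incidence x y ≤ 𝟙 (Q y)
  unique-once y with Q y in qy
  ... | false = ≤-reflexive (sum-replicate-zero m)
  ... | true = subst (_≤ 1) (count≡∑𝟙 (λ x → R y x ∧ P x)) (unique y qy)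

infixl 30 _+₅_

-- Defined so that i +₅ 3F and i +₅ 4F are definitionally the prev (prev i) and
-- prev i of the statement.
_+₅_ : Fin 5 → Fin 5 → Fin 5
i +₅ 0F = i
i +₅ 1F = next i
i +₅ 2F = next (next i)
i +₅ 3F = prev (prev i)
i +₅ 4F = prev i

A-nbrs B-nbrs : Fin 5 → Fin 5 → Bool
A-nbrs k j = j ==ᶠ k
B-nbrs k j = (j ==ᶠ prev k) ∨ (j ==ᶠ next k)

C5-+₅ : ∀ i k l → C5 (i +₅ k) (i +₅ l) ≡ C5 k l
C5-+₅ = toWitness {a? = all? λ i → all? λ k → all? λ l → C5 (i +₅ k) (i +₅ l) ≟ᵇ C5 k l} _

A-nbrs-+₅ : ∀ i k l → A-nbrs (i +₅ k) (i +₅ l) ≡ A-nbrs k l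
A-nbrs-+₅ = toWitness {a? = all? λ i → all? λ k → all? λ l → A-nbrs (i +₅ k) (i +₅ l) ≟ᵇ A-nbrs k l} _

B-nbrs-+₅ : ∀ i k l → B-nbrs (i +₅ k) (i +₅ l) ≡ B-nbrs k l
B-nbrs-+₅ = toWitness {a? = all? λ i → all? λ k → all? λ l → B-nbrs (i +₅ k) (i +₅ l) ≟ᵇ B-nbrs k l} _

+₅-surjective : ∀ i j → ∃ λ l → i +₅ l ≡ j
+₅-surjective = toWitness {a? = all? λ i → all? λ j → any? λ l → i +₅ l ≟ᶠ j} _

same-image⇒twins : ∀ (G : Graph) {m} {F : Fin m → Fin m → Bool} (f : Fin m → Fin (n G))
  → (∀ i j → adj G (f i) (f j) ≡ F i j)
  → ∀ {i j} → f i ≡ f j → ∀ k → F i k ≡ F j k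
same-image⇒twins G {F = F} f induces {i} {j} fi≡fj k = begin
  F i k              ≡⟨ induces i k ⟨
  adj G (f i) (f k)  ≡⟨ cong (λ x → adj G x (f k)) fi≡fj ⟩
  adj G (f j) (f k)  ≡⟨ induces j k ⟩
  F j k              ∎
  where open ≡-Reasoning

K3-twin-free : ∀ i j → (∀ k → K3 i k ≡ K3 j k) → i ≡ j
K3-twin-free = toWitness {a? = all? λ i → all? λ j → all? (λ k → K3 i k ≟ᵇ K3 j k) →-dec i ≟ᶠ j} _

P2∪P3-twins : ∀ i j → (∀ k → P2∪P3 i k ≡ P2∪P3 j k)
  → i ≡ j ⊎ (i ≡ 2F × j ≡ 4F) ⊎ (i ≡ 4F × j ≡ 2F)
P2∪P3-twins = toWitness {a? = all? λ i → all? λ j → all? (λ k → P2∪P3 i k ≟ᵇ P2∪P3 j k)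
  →-dec (i ≟ᶠ j ⊎-dec (i ≟ᶠ 2F ×-dec j ≟ᶠ 4F) ⊎-dec (i ≟ᶠ 4F ×-dec j ≟ᶠ 2F))} _

module Forbidden (G : Graph) (K3-free : ¬ HasInduced G K3) (P2∪P3-free : ¬ HasInduced G P2∪P3) where

  infix 7 _~_
  _~_ : Fin (n G) → Fin (n G) → Bool
  _~_ = adj G

  ~-sym : ∀ {x y b} → x ~ y ≡ b → y ~ x ≡ b
  ~-sym {x} {y} = trans (Graph.sym G y x)

  no-triangle : ∀ {a b c} → a ~ b ≡ true → b ~ c ≡ true → a ~ c ≡ true → ⊥
  no-triangle {a} {b} {c} ab bc ac = K3-free (f , injective , induces)
    where
    f : Fin 3 → Fin (n G)
    f 0F = a
    f 1F = b
    f 2F = c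
    induces : ∀ i j → f i ~ f j ≡ K3 i j
    induces 0F = λ { 0F → irrefl G a ; 1F → ab ; 2F → ac }
    induces 1F = λ { 0F → ~-sym ab ; 1F → irrefl G b ; 2F → bc }
    induces 2F = λ { 0F → ~-sym ac ; 1F → ~-sym bc ; 2F → irrefl G c }
    injective : Injective _≡_ _≡_ f
    injective {i} {j} fi≡fj = K3-twin-free i j (same-image⇒twins G f induces fi≡fj)

  ends-nonadjacent : ∀ {a b c} → a ~ b ≡ true → b ~ c ≡ true → a ~ c ≡ false
  ends-nonadjacent ab bc = ≢true⇒≡false (no-triangle ab bc)

  -- c and e are twins in P₂ ∪ P₃, so c ≢ e does not follow from the adjacencies.
  no-P2∪P3 : ∀ {a b c d e} → a ~ b ≡ true
    → c ~ d ≡ true → d ~ e ≡ true → c ~ e ≡ false → c ≢ e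
    → c ~ a ≡ false → c ~ b ≡ false → d ~ a ≡ false → d ~ b ≡ false → e ~ a ≡ false → e ~ b ≡ false
    → ⊥
  no-P2∪P3 {a} {b} {c} {d} {e} ab cd de ce c≢e ca cb da db ea eb = P2∪P3-free (f , injective , induces)
    where
    f : Fin 5 → Fin (n G)
    f 0F = a
    f 1F = b
    f 2F = c
    f 3F = d
    f 4F = e
    induces : ∀ i j → f i ~ f j ≡ P2∪P3 i j
    induces 0F = λ { 0F → irrefl G a ; 1F → ab ; 2F → ~-sym ca ; 3F → ~-sym da ; 4F → ~-sym ea }
    induces 1F = λ { 0F → ~-sym ab ; 1F → irrefl G b ; 2F → ~-sym cb ; 3F → ~-sym db ; 4F → ~-sym eb }
    induces 2F = λ { 0F → ca ; 1F → cb ; 2F → irrefl G c ; 3F → cd ; 4F → ce }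
    induces 3F = λ { 0F → da ; 1F → db ; 2F → ~-sym cd ; 3F → irrefl G d ; 4F → de }
    induces 4F = λ { 0F → ea ; 1F → eb ; 2F → ~-sym ce ; 3F → ~-sym de ; 4F → irrefl G e }
    injective : Injective _≡_ _≡_ f
    injective {i} {j} fi≡fj with P2∪P3-twins i j (same-image⇒twins G f induces fi≡fj)
    ... | inj₁ i≡j = i≡j
    ... | inj₂ (inj₁ (refl , refl)) = ⊥-elim (c≢e fi≡fj)
    ... | inj₂ (inj₂ (refl , refl)) = ⊥-elim (c≢e (≡.sym fi≡fj))

module AroundC5 (H : Graph) (K3-free : ¬ HasInduced H K3) (P2∪P3-free : ¬ HasInduced H P2∪P3)
                (v : Fin 5 → Fin (n H)) (cycle : ∀ i j → adj H (v i) (v j) ≡ C5 i j) where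

  open Forbidden H K3-free P2∪P3-free
  open Setup H v

  nbr-within : ℕ → Fin (n H) → Bool
  nbr-within k x = anyF (λ y → x ~ y ∧ within k y)

  v-within : ∀ k j → within k (v j) ≡ true
  v-within zero j = anyF-intro {p = λ i → v i ==ᶠ v j} j (==ᶠ-refl (v j))
  v-within (suc k) j = cong (_∨ nbr-within k (v j)) (v-within k j)

  within-nbr : ∀ k {x y} → x ~ y ≡ true → within k y ≡ true → within (suc k) x ≡ true
  within-nbr k {x} {y} x~y y∈ = begin
    within k x ∨ nbr-within k x  ≡⟨ cong (within k x ∨_) y-witnesses ⟩
    within k x ∨ true            ≡⟨ ∨-zeroʳ (within k x) ⟩
    true                         ∎
    where
    open ≡-Reasoning
    y-witnesses : nbr-within k x ≡ true
    y-witnesses = anyF-intro {p = λ y → x ~ y ∧ within k y} y (cong₂ _∧_ x~y y∈)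

  S⇒within : ∀ k {x} → S (suc k) x ≡ true → within (suc k) x ≡ true
  S⇒within k {x} = ∧-conicalˡ (within (suc k) x) (not (within k x))

  S⇒not-within : ∀ k {x} → S (suc k) x ≡ true → within k x ≡ false
  S⇒not-within k {x} = not≡true⇒≡false ∘ ∧-conicalʳ (within (suc k) x) (not (within k x))

  S⇒≢v : ∀ k {x} → S (suc k) x ≡ true → ∀ j → x ≢ v j
  S⇒≢v k hx j x≡vj = separates⇒≢ (within k) (v-within k j) (S⇒not-within k hx) (≡.sym x≡vj)

  outside-within-1⇒no-cycle-nbr : ∀ {x} → within 1 x ≡ false → ∀ j → x ~ v j ≡ false
  outside-within-1⇒no-cycle-nbr x∉ j =
    ≢true⇒≡false λ x~vj → ≡true⇒≢false (within-nbr 0 x~vj (v-within 0 j)) x∉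

  S2-no-cycle-nbr : ∀ {z} → S 2 z ≡ true → ∀ j → z ~ v j ≡ false
  S2-no-cycle-nbr = outside-within-1⇒no-cycle-nbr ∘ S⇒not-within 1

  step-inwards : ∀ k {x} → within (suc k) x ≡ true → within k x ≡ false
    → ∃ λ y → x ~ y ≡ true × within k y ≡ true
  step-inwards k {x} x∈ x∉ with anyF-elim (subst (λ b → b ∨ nbr-within k x ≡ true) x∉ x∈)
  ... | y , x~y∧y∈ = y , ∧-conicalˡ (x ~ y) (within k y) x~y∧y∈ , ∧-conicalʳ (x ~ y) (within k y) x~y∧y∈

  S1-cycle-nbr : ∀ {x} → S 1 x ≡ true → ∃ λ j → x ~ v j ≡ true
  S1-cycle-nbr hx with step-inwards 0 (S⇒within 0 hx) (S⇒not-within 0 hx)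
  ... | y , x~y , y∈S0 with anyF-elim y∈S0
  ...   | j , vj==y with ==ᶠ⇒≡ (v j) y vj==y
  ...     | refl = j , x~y

  S-step : ∀ k {x} → S (suc (suc k)) x ≡ true → ∃ λ y → x ~ y ≡ true × S (suc k) y ≡ true
  S-step k hx with step-inwards (suc k) (S⇒within (suc k) hx) (S⇒not-within (suc k) hx)
  ... | y , x~y , y∈ = y , x~y , cong₂ _∧_ y∈ (cong not y∉)
    where
    y∉ : within k y ≡ false
    y∉ = ≢true⇒≡false λ y∈k → ≡true⇒≢false (within-nbr k x~y y∈k) (S⇒not-within (suc k) hx)

  A⇒S1 : ∀ k {x} → A k x ≡ true → S 1 x ≡ true
  A⇒S1 k {x} = ∧-conicalˡ (S 1 x) _

  B⇒S1 : ∀ k {x} → B k x ≡ true → S 1 x ≡ true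
  B⇒S1 k {x} = ∧-conicalˡ (S 1 x) _

  A-trace : ∀ {k x} → A k x ≡ true → ∀ j → x ~ v j ≡ A-nbrs k j
  A-trace {k} {x} = allF-⇔ᵇ-elim ∘ ∧-conicalʳ (S 1 x) _

  B-trace : ∀ {k x} → B k x ≡ true → ∀ j → x ~ v j ≡ B-nbrs k j
  B-trace {k} {x} = allF-⇔ᵇ-elim ∘ ∧-conicalʳ (S 1 x) _

  trace⇒A : ∀ {k x} → S 1 x ≡ true → (∀ j → x ~ v j ≡ A-nbrs k j) → A k x ≡ true
  trace⇒A hx trace = cong₂ _∧_ hx (allF-⇔ᵇ-intro trace)

  trace⇒B : ∀ {k x} → S 1 x ≡ true → (∀ j → x ~ v j ≡ B-nbrs k j) → B k x ≡ true
  trace⇒B hx trace = cong₂ _∧_ hx (allF-⇔ᵇ-intro trace)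

  at-most-one-nbr-in : ∀ x X
    → (∀ {y y′} → y ≢ y′ → x ~ y ≡ true → X y ≡ true → x ~ y′ ≡ true → X y′ ≡ true → ⊥)
    → count (Nbr∩ H x X) ≤ 1
  at-most-one-nbr-in x X no-two = count≤1 λ {y} {y′} y≢y′ hy hy′ →
    no-two y≢y′ (∧-conicalˡ (x ~ y) (X y) hy) (∧-conicalʳ (x ~ y) (X y) hy)
                (∧-conicalˡ (x ~ y′) (X y′) hy′) (∧-conicalʳ (x ~ y′) (X y′) hy′)

  module Frame (i : Fin 5) where

    u : Fin 5 → Fin (n H)
    u l = v (i +₅ l)

    u-adj : ∀ k l → u k ~ u l ≡ C5 k l
    u-adj k l = trans (cycle (i +₅ k) (i +₅ l)) (C5-+₅ i k l)

    A-in-frame : ∀ k {x} → A (i +₅ k) x ≡ true → ∀ l → x ~ u l ≡ A-nbrs k l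
    A-in-frame k hx l = trans (A-trace hx (i +₅ l)) (A-nbrs-+₅ i k l)

    B-in-frame : ∀ k {x} → B (i +₅ k) x ≡ true → ∀ l → x ~ u l ≡ B-nbrs k l
    B-in-frame k hx l = trans (B-trace hx (i +₅ l)) (B-nbrs-+₅ i k l)

    S1≢u : ∀ {x} → S 1 x ≡ true → ∀ l → x ≢ u l
    S1≢u hx l = S⇒≢v 0 hx (i +₅ l)

    frame⇒trace : ∀ {x} {P : Fin 5 → Bool} → (∀ l → x ~ u l ≡ P (i +₅ l)) → ∀ j → x ~ v j ≡ P j
    frame⇒trace in-frame j with +₅-surjective i j
    ... | l , refl = in-frame l

    A-from-frame : ∀ k {x} → S 1 x ≡ true → (∀ l → x ~ u l ≡ A-nbrs k l) → A (i +₅ k) x ≡ true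
    A-from-frame k hx in-frame = trace⇒A hx (frame⇒trace λ l → trans (in-frame l) (≡.sym (A-nbrs-+₅ i k l)))

    B-from-frame : ∀ k {x} → S 1 x ≡ true → (∀ l → x ~ u l ≡ B-nbrs k l) → B (i +₅ k) x ≡ true
    B-from-frame k hx in-frame = trace⇒B hx (frame⇒trace λ l → trans (in-frame l) (≡.sym (B-nbrs-+₅ i k l)))

    nbr-classification : ∀ {y} → S 1 y ≡ true → y ~ u 0F ≡ true
      → A i y ≡ true ⊎ B (next i) y ≡ true ⊎ B (prev i) y ≡ true
    nbr-classification {y} hy y~u0 =
      classify (ends-nonadjacent y~u0 (u-adj 0F 1F)) (ends-nonadjacent y~u0 (u-adj 0F 4F))
      where
      classify : y ~ u 1F ≡ false → y ~ u 4F ≡ false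
        → A i y ≡ true ⊎ B (next i) y ≡ true ⊎ B (prev i) y ≡ true
      classify y≁u1 y≁u4 with y ~ u 2F in y~u2 | y ~ u 3F in y~u3
      ... | true | true = ⊥-elim (no-triangle y~u2 (u-adj 2F 3F) y~u3)
      ... | false | false =
        inj₁ (A-from-frame 0F hy λ { 0F → y~u0 ; 1F → y≁u1 ; 2F → y~u2 ; 3F → y~u3 ; 4F → y≁u4 })
      ... | true | false =
        inj₂ (inj₁ (B-from-frame 1F hy λ { 0F → y~u0 ; 1F → y≁u1 ; 2F → y~u2 ; 3F → y~u3 ; 4F → y≁u4 }))
      ... | false | true =
        inj₂ (inj₂ (B-from-frame 4F hy λ { 0F → y~u0 ; 1F → y≁u1 ; 2F → y~u2 ; 3F → y~u3 ; 4F → y≁u4 }))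

  S1-classification : ∀ {y} → S 1 y ≡ true → ∃ λ k → A k y ≡ true ⊎ B k y ≡ true
  S1-classification {y} hy = let j , y~vj = S1-cycle-nbr hy in place j (Frame.nbr-classification j hy y~vj)
    where
    place : ∀ j → A j y ≡ true ⊎ B (next j) y ≡ true ⊎ B (prev j) y ≡ true
      → ∃ λ k → A k y ≡ true ⊎ B k y ≡ true
    place j (inj₁ y∈A) = j , inj₁ y∈A
    place j (inj₂ (inj₁ y∈B)) = next j , inj₂ y∈B
    place j (inj₂ (inj₂ y∈B)) = prev j , inj₂ y∈B

  misses-opposite-edge : ∀ {k y} → A k y ≡ true ⊎ B k y ≡ true
    → y ~ v (k +₅ 2F) ≡ false × y ~ v (k +₅ 3F) ≡ false
  misses-opposite-edge {k} (inj₁ y∈A) = Frame.A-in-frame k 0F y∈A 2F , Frame.A-in-frame k 0F y∈A 3F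
  misses-opposite-edge {k} (inj₂ y∈B) = Frame.B-in-frame k 0F y∈B 2F , Frame.B-in-frame k 0F y∈B 3F

  no-P3-leaving-S1 : ∀ {y z w} → S 1 y ≡ true → y ~ z ≡ true → z ~ w ≡ true → y ≢ w
    → (∀ j → z ~ v j ≡ false) → (∀ j → w ~ v j ≡ false) → ⊥
  no-P3-leaving-S1 hy y~z z~w y≢w z≁C w≁C =
    let k , y∈AB = S1-classification hy
        y≁a , y≁b = misses-opposite-edge y∈AB
    in no-P2∪P3 (Frame.u-adj k 2F 3F) y~z z~w (ends-nonadjacent y~z z~w) y≢w
         y≁a y≁b (z≁C _) (z≁C _) (w≁C _) (w≁C _)

  S3-empty : ∀ {w} → S 3 w ≡ true → ⊥
  S3-empty {w} hw =
    let z , w~z , hz = S-step 1 hw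
        y , z~y , hy = S-step 0 hz
    in no-P3-leaving-S1 hy (~-sym z~y) (~-sym w~z) (separates⇒≢ (within 1) (S⇒within 0 hy) w∉W1)
         (S2-no-cycle-nbr hz) (outside-within-1⇒no-cycle-nbr w∉W1)
    where
    w∉W1 : within 1 w ≡ false
    w∉W1 = ∨-conicalˡ (within 1 w) _ (S⇒not-within 2 hw)

  S-empty-from-3 : ∀ j → j ≥ 3 → ∀ x → S j x ≡ false
  S-empty-from-3 (suc (suc (suc k))) (s≤s (s≤s (s≤s _))) x = ≢true⇒≡false (beyond k)
    where
    beyond : ∀ k {x} → S (3 + k) x ≡ true → ⊥
    beyond zero hx = S3-empty hx
    beyond (suc k) hx = let _ , _ , hy = S-step (suc (suc k)) hx in beyond k hy

  S2-independent : Independent H (S 2)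
  S2-independent z z′ hz hz′ = ≢true⇒≡false λ z~z′ →
    let y , z~y , hy = S-step 0 hz
    in no-P3-leaving-S1 hy (~-sym z~y) z~z′ (separates⇒≢ (within 1) (S⇒within 0 hy) (S⇒not-within 1 hz′))
         (S2-no-cycle-nbr hz) (S2-no-cycle-nbr hz′)

  B-independent : ∀ k → Independent H (B k)
  B-independent k x y hx hy = ends-nonadjacent (B-in-frame 0F hx 1F) (~-sym (B-in-frame 0F hy 1F))
    where open Frame k

  module Properties (i : Fin 5) where
    open Frame i

    Aᵢ-at-most-one : count (A i) ≤ 1
    Aᵢ-at-most-one = count≤1 two-distinct
      where
      two-distinct : ∀ {x y} → x ≢ y → A i x ≡ true → A i y ≡ true → ⊥
      two-distinct {x} {y} x≢y hx hy =
        no-P2∪P3 (u-adj 2F 3F) (αx 0F) (~-sym (αy 0F)) (ends-nonadjacent (αx 0F) (~-sym (αy 0F))) x≢y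
          (αx 2F) (αx 3F) (u-adj 0F 2F) (u-adj 0F 3F) (αy 2F) (αy 3F)
        where
        αx : ∀ l → x ~ u l ≡ A-nbrs 0F l
        αx = A-in-frame 0F hx
        αy : ∀ l → y ~ u l ≡ A-nbrs 0F l
        αy = A-in-frame 0F hy

    Aᵢ-Aᵢ₊₁-anticomplete : Anticomplete H (A i) (A (next i))
    Aᵢ-Aᵢ₊₁-anticomplete x y hx hy = ≢true⇒≡false λ x~y →
      no-P2∪P3 (u-adj 3F 4F) x~y (αy 1F) (αx 1F) (S1≢u (A⇒S1 i hx) 1F)
        (αx 3F) (αx 4F) (αy 3F) (αy 4F) (u-adj 1F 3F) (u-adj 1F 4F)
      where
      αx : ∀ l → x ~ u l ≡ A-nbrs 0F l
      αx = A-in-frame 0F hx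
      αy : ∀ l → y ~ u l ≡ A-nbrs 1F l
      αy = A-in-frame 1F hy

    Aᵢ-Aᵢ₊₂-complete : Complete H (A i) (A (next (next i)))
    Aᵢ-Aᵢ₊₂-complete x y hx hy = ≢false⇒≡true λ x≁y →
      no-P2∪P3 (αy 2F) (αx 0F) (u-adj 0F 4F) (αx 4F) (S1≢u (A⇒S1 i hx) 4F)
        x≁y (αx 2F) (~-sym (αy 0F)) (u-adj 0F 2F) (~-sym (αy 4F)) (u-adj 4F 2F)
      where
      αx : ∀ l → x ~ u l ≡ A-nbrs 0F l
      αx = A-in-frame 0F hx
      αy : ∀ l → y ~ u l ≡ A-nbrs 2F l
      αy = A-in-frame 2F hy

    Aᵢ-Bᵢ-anticomplete : Anticomplete H (A i) (B i)
    Aᵢ-Bᵢ-anticomplete x y hx hy = ≢true⇒≡false λ x~y →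
      no-P2∪P3 (u-adj 2F 3F) (~-sym x~y) (αx 0F) (βy 0F) (S1≢u (B⇒S1 i hy) 0F)
        (βy 2F) (βy 3F) (αx 2F) (αx 3F) (u-adj 0F 2F) (u-adj 0F 3F)
      where
      αx : ∀ l → x ~ u l ≡ A-nbrs 0F l
      αx = A-in-frame 0F hx
      βy : ∀ l → y ~ u l ≡ B-nbrs 0F l
      βy = B-in-frame 0F hy

    Aᵢ-Bᵢ₋₂-complete : Complete H (A i) (B (prev (prev i)))
    Aᵢ-Bᵢ₋₂-complete x y hx hy = ≢false⇒≡true λ x≁y →
      no-P2∪P3 (αx 0F) (u-adj 3F 2F) (~-sym (βy 2F)) (~-sym (βy 3F)) (≢-sym (S1≢u (B⇒S1 (prev (prev i)) hy) 3F))
        (~-sym (αx 3F)) (u-adj 3F 0F) (~-sym (αx 2F)) (u-adj 2F 0F) (~-sym x≁y) (βy 0F)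
      where
      αx : ∀ l → x ~ u l ≡ A-nbrs 0F l
      αx = A-in-frame 0F hx
      βy : ∀ l → y ~ u l ≡ B-nbrs 3F l
      βy = B-in-frame 3F hy

    Aᵢ-Bᵢ₊₂-complete : Complete H (A i) (B (next (next i)))
    Aᵢ-Bᵢ₊₂-complete x y hx hy = ≢false⇒≡true λ x≁y →
      no-P2∪P3 (αx 0F) (u-adj 2F 3F) (~-sym (βy 3F)) (~-sym (βy 2F)) (≢-sym (S1≢u (B⇒S1 (next (next i)) hy) 2F))
        (~-sym (αx 2F)) (u-adj 2F 0F) (~-sym (αx 3F)) (u-adj 3F 0F) (~-sym x≁y) (βy 0F)
      where
      αx : ∀ l → x ~ u l ≡ A-nbrs 0F l
      αx = A-in-frame 0F hx
      βy : ∀ l → y ~ u l ≡ B-nbrs 2F l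
      βy = B-in-frame 2F hy

    Aᵢ-Bᵢ₋₁-anticomplete : Anticomplete H (A i) (B (prev i))
    Aᵢ-Bᵢ₋₁-anticomplete x y hx hy = ends-nonadjacent (A-in-frame 0F hx 0F) (~-sym (B-in-frame 4F hy 0F))

    Aᵢ-Bᵢ₊₁-anticomplete : Anticomplete H (A i) (B (next i))
    Aᵢ-Bᵢ₊₁-anticomplete x y hx hy = ends-nonadjacent (A-in-frame 0F hx 0F) (~-sym (B-in-frame 1F hy 0F))

    Bᵢ-Bᵢ₊₂-anticomplete : Anticomplete H (B i) (B (next (next i)))
    Bᵢ-Bᵢ₊₂-anticomplete x y hx hy = ends-nonadjacent (B-in-frame 0F hx 1F) (~-sym (B-in-frame 2F hy 1F))

    Bᵢ-sees-all-but-one : ∀ b → B i b ≡ true → ∀ j → (j ≡ prev i ⊎ j ≡ next i)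
      → count (Nbr∩ H b (B j)) ≥ count (B j) ∸ 1
    Bᵢ-sees-all-but-one b hb _ (inj₁ refl) =
      count∸1≤count-∧ (adj H b) (B (prev i)) λ {c} {c′} c≢c′ hc hc′ b≁c b≁c′ →
        no-P2∪P3 (βb 1F) (B-in-frame 4F hc 3F) (~-sym (B-in-frame 4F hc′ 3F))
          (B-independent (prev i) c c′ hc hc′) c≢c′
          (~-sym b≁c) (B-in-frame 4F hc 1F) (~-sym (βb 3F)) (u-adj 3F 1F) (~-sym b≁c′) (B-in-frame 4F hc′ 1F)
      where
      βb : ∀ l → b ~ u l ≡ B-nbrs 0F l
      βb = B-in-frame 0F hb
    Bᵢ-sees-all-but-one b hb _ (inj₂ refl) =
      count∸1≤count-∧ (adj H b) (B (next i)) λ {c} {c′} c≢c′ hc hc′ b≁c b≁c′ →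
        no-P2∪P3 (βb 4F) (B-in-frame 1F hc 2F) (~-sym (B-in-frame 1F hc′ 2F))
          (B-independent (next i) c c′ hc hc′) c≢c′
          (~-sym b≁c) (B-in-frame 1F hc 4F) (~-sym (βb 2F)) (u-adj 2F 4F) (~-sym b≁c′) (B-in-frame 1F hc′ 4F)
      where
      βb : ∀ l → b ~ u l ≡ B-nbrs 0F l
      βb = B-in-frame 0F hb

    Aᵢ-nonempty⇒Bᵢ₋₂-Bᵢ₊₂-anticomplete : (∃ λ x → A i x ≡ true)
      → Anticomplete H (B (prev (prev i))) (B (next (next i)))
    Aᵢ-nonempty⇒Bᵢ₋₂-Bᵢ₊₂-anticomplete (x , hx) y z hy hz =
      ends-nonadjacent (~-sym (Aᵢ-Bᵢ₋₂-complete x y hx hy)) (Aᵢ-Bᵢ₊₂-complete x z hx hz)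

    Aᵢ-S2-anticomplete : Anticomplete H (A i) (S 2)
    Aᵢ-S2-anticomplete x z hx hz = ≢true⇒≡false λ x~z →
      no-P2∪P3 (u-adj 2F 3F) (~-sym x~z) (αx 0F) (z≁C i) (S⇒≢v 1 hz i)
        (z≁C _) (z≁C _) (αx 2F) (αx 3F) (u-adj 0F 2F) (u-adj 0F 3F)
      where
      αx : ∀ l → x ~ u l ≡ A-nbrs 0F l
      αx = A-in-frame 0F hx
      z≁C : ∀ j → z ~ v j ≡ false
      z≁C = S2-no-cycle-nbr hz

    S2-vertex-sees-at-most-one-of-Bᵢ : ∀ z → S 2 z ≡ true → count (Nbr∩ H z (B i)) ≤ 1
    S2-vertex-sees-at-most-one-of-Bᵢ z hz = at-most-one-nbr-in z (B i) λ y≢y′ z~y y∈B z~y′ y′∈B →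
      no-P2∪P3 (u-adj 2F 3F) (~-sym z~y) z~y′ (B-independent i _ _ y∈B y′∈B) y≢y′
        (B-in-frame 0F y∈B 2F) (B-in-frame 0F y∈B 3F) (z≁C _) (z≁C _)
        (B-in-frame 0F y′∈B 2F) (B-in-frame 0F y′∈B 3F)
      where
      z≁C : ∀ j → z ~ v j ≡ false
      z≁C = S2-no-cycle-nbr hz

    Bᵢ-vertex-sees-at-most-one-of-S2 : ∀ y → B i y ≡ true → count (Nbr∩ H y (S 2)) ≤ 1
    Bᵢ-vertex-sees-at-most-one-of-S2 y hy = at-most-one-nbr-in y (S 2) λ z≢z′ y~z z∈S2 y~z′ z′∈S2 →
      no-P2∪P3 (u-adj 2F 3F) (~-sym y~z) y~z′ (S2-independent _ _ z∈S2 z′∈S2) z≢z′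
        (S2-no-cycle-nbr z∈S2 _) (S2-no-cycle-nbr z∈S2 _) (βy 2F) (βy 3F)
        (S2-no-cycle-nbr z′∈S2 _) (S2-no-cycle-nbr z′∈S2 _)
      where
      βy : ∀ l → y ~ u l ≡ B-nbrs 0F l
      βy = B-in-frame 0F hy

  S2-≤-∑B : count (S 2) ≤ ∑[ k < 5 ] count (B k)
  S2-≤-∑B = ≤-trans (double-counting (adj H) {S 2} {in-some-B} covered unique) (count-anyF B)
    where
    in-some-B : Fin (n H) → Bool
    in-some-B y = anyF (λ k → B k y)
    covered : ∀ z → S 2 z ≡ true → ∃ λ y → in-some-B y ≡ true × y ~ z ≡ true
    covered z hz =
      let y , z~y , hy = S-step 0 hz
          k , y∈AB = S1-classification hy
          y∉A = λ y∈A → ≡true⇒≢false (~-sym z~y) (Properties.Aᵢ-S2-anticomplete k y z y∈A hz)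
          y∈Bₖ = [ ⊥-elim ∘ y∉A , id ]′ y∈AB
      in y , anyF-intro {p = λ k → B k y} k y∈Bₖ , ~-sym z~y
    unique : ∀ y → in-some-B y ≡ true → count (Nbr∩ H y (S 2)) ≤ 1
    unique y y∈B =
      let k , y∈Bₖ = anyF-elim {p = λ k → B k y} y∈B in Properties.Bᵢ-vertex-sees-at-most-one-of-S2 k y y∈Bₖ

lemma3p1 : (H : Graph) → Connected H → Imperfect H
  → ¬ HasInduced H K3 → ¬ HasInduced H P2∪P3
  → (v : Fin 5 → Fin (n H)) → Setup.IsInducedC5 H v
  → (i : Fin 5)
  → let open Setup H v in
    -- (P1)
    count (A i) ≤ 1
    -- (P2)
    × Independent H (B i)
    -- (P3)
    × (Anticomplete H (A i) (A (next i)) × Complete H (A i) (A (next (next i))))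
    -- (P4)
    × (Anticomplete H (A i) (B i)
       × Complete H (A i) (B (prev (prev i))) × Complete H (A i) (B (next (next i))))
    -- (P5)
    × (Anticomplete H (A i) (B (prev i)) × Anticomplete H (A i) (B (next i)))
    -- (P6)
    × Anticomplete H (B i) (B (next (next i)))
    -- (P7)
    × (∀ b → B i b ≡ true → ∀ j → (j ≡ prev i ⊎ j ≡ next i)
         → count (Nbr∩ H b (B j)) ≥ count (B j) ∸ 1)
    -- (P8)
    × ((∃ λ x → A i x ≡ true) → Anticomplete H (B (prev (prev i))) (B (next (next i))))
    -- (P9)
    × ((∀ j → j ≥ 3 → ∀ x → S j x ≡ false) × Independent H (S 2))
    -- (P10)
    × Anticomplete H (A i) (S 2)
    -- (P11)
    × ((∀ z → S 2 z ≡ true → count (Nbr∩ H z (B i)) ≤ 1)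
       × (∀ y → B i y ≡ true → count (Nbr∩ H y (S 2)) ≤ 1)
       × count (B zero) + count (B (suc zero)) + count (B (suc (suc zero)))
         + count (B (suc (suc (suc zero)))) + count (B (suc (suc (suc (suc zero)))))
         ≥ count (S 2))
lemma3p1 H _ _ K3-free P2∪P3-free v (_ , cycle) i =
  Aᵢ-at-most-one , B-independent i
  , (Aᵢ-Aᵢ₊₁-anticomplete , Aᵢ-Aᵢ₊₂-complete)
  , (Aᵢ-Bᵢ-anticomplete , Aᵢ-Bᵢ₋₂-complete , Aᵢ-Bᵢ₊₂-complete)
  , (Aᵢ-Bᵢ₋₁-anticomplete , Aᵢ-Bᵢ₊₁-anticomplete)
  , Bᵢ-Bᵢ₊₂-anticomplete
  , Bᵢ-sees-all-but-one
  , Aᵢ-nonempty⇒Bᵢ₋₂-Bᵢ₊₂-anticomplete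
  , (S-empty-from-3 , S2-independent)
  , Aᵢ-S2-anticomplete
  , ( S2-vertex-sees-at-most-one-of-Bᵢ
    , Bᵢ-vertex-sees-at-most-one-of-S2
    , ≤-trans S2-≤-∑B (≤-reflexive (+-reassoc₅ (count (B 0F)) (count (B 1F)) (count (B 2F))
                                                (count (B 3F)) (count (B 4F)))))
  where
  open Setup H v
  open AroundC5 H K3-free P2∪P3-free v cycle
  open Properties i
  +-reassoc₅ : ∀ a b c d e → a + (b + (c + (d + (e + 0)))) ≡ a + b + c + d + e
  +-reassoc₅ = solve 5 (λ a b c d e → a :+ (b :+ (c :+ (d :+ (e :+ con 0)))) := a :+ b :+ c :+ d :+ e) refl
    where open +-*-Solver
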